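{- Given the matrix tuple $\underline{q}$ (of dimension $d'=2rd$, with $I_{rdd'}-L(\underline{q})$ invertible and $(\widetilde{T_d})_{ij}(\underline{q})\neq 0$), one can compute another matrix tuple $\underline{p'}\in \mathrm{Mat}_{dd'}(\mathbb{Q})^n$ that is a witness of $\mathrm{ncrank}(T)>r$, i.e. $\mathrm{rank}(T(\underline{p'}))>r\,dd'$.
   Context: Let $T=A_0+\sum_{i=1}^n A_i x_i$ be an $s\times s$ linear matrix over $\mathbb{Q}$ in noncommuting variables, and $\underline{p}=(p_1,\dots,p_n)\in \mathrm{Mat}_d(\mathbb{Q})^n$ with $\mathrm{rank}(T(\underline{p}))\ge rd$. Let $T_d(Z)=A_0\otimes I_d+\sum_i A_i\otimes Z_i$ with $Z_i=(z^{(i)}_{jk})$ generic $d\times d$ matrices of noncommuting indeterminates, and write $T_d(Z_1+p_1,\dots,Z_n+p_n)=U\begin{pmatrix} I_{rd}-L & A\\ B & C\end{pmatrix}V$ with $U,V$ invertible over $\mathbb{Q}$ and $L,A,B,C$ linear in the $Z$ variables. Suppose a deterministic $\mathrm{poly}(n,r,d)$-time procedure has produced a tuple $\underline{q}$ of $d'\times d'$ matrices ($d'=2rd$) for the $Z$ variables with $I_{rdd'}-L(\underline{q})$ invertible and $C_{ij}-B_i(I_{rd}-L(\underline{q}))^{ -1}A_j\neq 0$ for some $i,j$. Here $\mathrm{ncrank}$ is the rank over the free skew field. -}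

module Defs where

open import Data.Nat using (ℕ; zero; suc; _+_; _*_)
open import Data.Fin using (Fin; zero; suc; remQuot; splitAt; _≟_)
open import Data.Product using (Σ; _×_; _,_; proj₁; proj₂)
open import Data.Sum using (inj₁; inj₂)
open import Data.Rational as Q using (ℚ; 0ℚ; 1ℚ)
open import Relation.Binary.PropositionalEquality using (_≡_)
open import Relation.Nullary using (yes; no)

Mat : ℕ → ℕ → Set
Mat m n = Fin m → Fin n → ℚ

sumFin : (k : ℕ) → (Fin k → ℚ) → ℚ
sumFin zero    f = 0ℚ
sumFin (suc k) f = f zero Q.+ sumFin k (λ i → f (suc i))

private variable a b c e m n k : ℕ

zeroM : Mat m n
zeroM i j = 0ℚ

idM : Mat n n
idM i j with i ≟ j
... | yes _ = 1ℚ
... | no  _ = 0ℚ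

_⊕_ : Mat m n → Mat m n → Mat m n
(M ⊕ N) i j = M i j Q.+ N i j

negM : Mat m n → Mat m n
negM M i j = Q.- M i j

_⊖_ : Mat m n → Mat m n → Mat m n
M ⊖ N = M ⊕ negM N

infixl 7 _·_
_·_ : Mat m k → Mat k n → Mat m n
_·_ {k = k} M N i j = sumFin k (λ t → M i t Q.* N t j)

sumMat : (k : ℕ) → (Fin k → Mat m n) → Mat m n
sumMat zero    F = zeroM
sumMat (suc k) F = F zero ⊕ sumMat k (λ i → F (suc i))

-- Kronecker product; index (i , i') of the product is `combine i i'`
-- (i is the outer/block index).
_⊗_ : Mat m n → Mat a b → Mat (m * a) (n * b)
_⊗_ {m = m} {n = n} {a = a} {b = b} M N i j =
  M (proj₁ (remQuot {m} a i)) (proj₁ (remQuot {n} b j)) Q.*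
  N (proj₂ (remQuot {m} a i)) (proj₂ (remQuot {n} b j))

unitM : Fin n → Fin n → Mat n n
unitM j k x y with x ≟ j | y ≟ k
... | yes _ | yes _ = 1ℚ
... | _     | _     = 0ℚ

block : Mat a c → Mat a e → Mat b c → Mat b e → Mat (a + b) (c + e)
block {a = a} {c = c} P Q' R S i j with splitAt a i | splitAt c j
... | inj₁ x | inj₁ y = P x y
... | inj₁ x | inj₂ y = Q' x y
... | inj₂ x | inj₁ y = R x y
... | inj₂ x | inj₂ y = S x y

_≐_ : Mat m n → Mat m n → Set
M ≐ N = ∀ i j → M i j ≡ N i j

IsInverse : Mat n m → Mat m n → Set
IsInverse N M = ((N · M) ≐ idM) × ((M · N) ≐ idM)

RankAtLeast : Mat m n → ℕ → Set
RankAtLeast {m} {n} M k =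
  Σ (Fin k → Fin n) λ f →
    (coef : Fin k → ℚ) →
    (∀ i → sumFin k (λ t → M i (f t) Q.* coef t) ≡ 0ℚ) →
    ∀ t → coef t ≡ 0ℚ

-- Evaluation T(p) = A₀ ⊗ I_e + Σ_i A_i ⊗ p_i of the linear matrix
-- T = A₀ + Σ_i A_i x_i at a tuple p of e × e matrices.
evalT : {s : ℕ} (n : ℕ) → Mat s s → (Fin n → Mat s s) →
        (Fin n → Mat e e) → Mat (s * e) (s * e)
evalT n A₀ As p = (A₀ ⊗ idM) ⊕ sumMat n (λ i → As i ⊗ p i)

-- Linear (affine) matrices of size a × b over ℚ in the n·d·d noncommuting
-- variables z^{(i)}_{jk} (i : Fin n, j k : Fin d).
record LinMat (n d a b : ℕ) : Set where
  field
    const : Mat a b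
    coeff : Fin n → Fin d → Fin d → Mat a b
open LinMat public

_≋_ : ∀ {n d} → LinMat n d a b → LinMat n d a b → Set
L ≋ L' = (const L ≐ const L') × (∀ i j k → coeff L i j k ≐ coeff L' i j k)

sandwich : ∀ {n d} → Mat a c → LinMat n d c e → Mat e b → LinMat n d a b
const (sandwich U L V) = U · const L · V
coeff (sandwich U L V) i j k = U · coeff L i j k · V

idMinus : ∀ {n d} → LinMat n d a a → LinMat n d a a
const (idMinus L) = idM ⊖ const L
coeff (idMinus L) i j k = negM (coeff L i j k)

blockL : ∀ {n d} → LinMat n d a c → LinMat n d a e → LinMat n d b c →
         LinMat n d b e → LinMat n d (a + b) (c + e)
const (blockL P Q' R S) = block (const P) (const Q') (const R) (const S)
coeff (blockL P Q' R S) i j k =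
  block (coeff P i j k) (coeff Q' i j k) (coeff R i j k) (coeff S i j k)

evalLin : ∀ {n d} → LinMat n d a b → (Fin n → Fin d → Fin d → Mat e e) →
          Mat (a * e) (b * e)
evalLin {n = n} {d = d} M q =
  (const M ⊗ idM) ⊕
  sumMat n (λ i → sumMat d (λ j → sumMat d (λ k → coeff M i j k ⊗ q i j k)))

-- T_d(Z₁ + p₁, …, Z_n + p_n) as a linear matrix in the variables z^{(i)}_{jk}:
-- constant part T(p), coefficient of z^{(i)}_{jk} is A_i ⊗ E_{jk}.
TdShift : {s d : ℕ} (n : ℕ) → Mat s s → (Fin n → Mat s s) →
          (Fin n → Mat d d) → LinMat n d (s * d) (s * d)
const (TdShift n A₀ As p) = evalT n A₀ As p
coeff (TdShift n A₀ As p) i j k = As i ⊗ unitM j k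

module Submission where

-- Substituting the d′ × d′ blocks qᵢⱼₖ for the variables z⁽ⁱ⁾ⱼₖ turns T_d(Z + p) into T(p′),
-- p′ᵢ = pᵢ ⊗ I + Σⱼₖ Eⱼₖ ⊗ qᵢⱼₖ, up to a reordering of rows and columns, and turns the
-- factorisation T_d(Z + p) = U [I − L, A; B, C] V into T(p′) ≅ (U ⊗ I) M (V ⊗ I) with
-- M = [I − L(q), A(q); B(q), C(q)]. Since I − L(q) is invertible and the Schur complement
-- C(q) − B(q)(I − L(q))⁻¹A(q) is nonzero at ((i, x), (j, y)), the first r d d′ columns of M
-- together with its column (j, y) are independent. So T(p′) · H has independent columns for
-- H = (V⁻¹ ⊗ I) · (those r d d′ + 1 unit columns), and Gaussian elimination turns this into
-- r d d′ + 1 independent columns of T(p′) itself.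

open import Data.Empty using (⊥-elim)
open import Data.Fin using (Fin; zero; suc; combine; remQuot; splitAt; _↑ˡ_; _↑ʳ_; punchIn; punchOut; _≟_)
open import Data.Fin.Properties
  using (remQuot-combine; combine-surjective; combine-injectiveˡ; combine-injectiveʳ;
         splitAt-↑ˡ; splitAt-↑ʳ; punchInᵢ≢i; punchIn-punchOut; ¬∀⟶∃¬)
open import Data.Nat as ℕ using (ℕ; zero; suc)
open import Data.Product using (Σ; ∃; _×_; _,_; proj₁; proj₂; uncurry)
open import Data.Rational as Q using (ℚ; 0ℚ; 1ℚ; NonZero; 1/_; ≢-nonZero)
import Data.Rational.Properties as ℚP
open import Data.Rational.Solver using (module +-*-Solver)
open import Data.Sum using ([_,_]′)
open import Data.Vec.Functional using (Vector; _∷_; removeAt)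
open import Defs
open import Function using (_∘_)
open import Relation.Binary.PropositionalEquality
open import Relation.Nullary using (¬_; yes; no)

open import Algebra.Bundles using (CommutativeMonoid)
open import Algebra.Properties.CommutativeSemigroup
  (CommutativeMonoid.commutativeSemigroup ℚP.+-0-commutativeMonoid) using (interchange; x∙yz≈y∙xz)
open import Algebra.Properties.Group ℚP.+-0-group using (inverseˡ-unique)

private variable a b c d e k l m n p : ℕ

IsZero : Vector ℚ k → Set
IsZero v = ∀ i → v i ≡ 0ℚ

module Sums where
  open Q using (_+_; _*_; -_)
  open +-*-Solver

  sumFin-cong : ∀ k {f g : Vector ℚ k} → f ≗ g → sumFin k f ≡ sumFin k g
  sumFin-cong zero    f≗g = refl
  sumFin-cong (suc k) f≗g = cong₂ _+_ (f≗g zero) (sumFin-cong k (f≗g ∘ suc))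

  sumFin-0 : ∀ k {f : Vector ℚ k} → IsZero f → sumFin k f ≡ 0ℚ
  sumFin-0 zero    f≡0 = refl
  sumFin-0 (suc k) f≡0 = trans (cong₂ _+_ (f≡0 zero) (sumFin-0 k (f≡0 ∘ suc))) (ℚP.+-identityˡ 0ℚ)

  sumFin-distrib-+ : ∀ k (f g : Vector ℚ k) →
    sumFin k (λ i → f i + g i) ≡ sumFin k f + sumFin k g
  sumFin-distrib-+ zero    f g = sym (ℚP.+-identityˡ 0ℚ)
  sumFin-distrib-+ (suc k) f g =
    trans (cong (f zero + g zero +_) (sumFin-distrib-+ k (f ∘ suc) (g ∘ suc)))
          (interchange (f zero) (g zero) (sumFin k (f ∘ suc)) (sumFin k (g ∘ suc)))

  sumFin-neg : ∀ k (f : Vector ℚ k) → sumFin k (λ i → - f i) ≡ - sumFin k f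
  sumFin-neg zero    f = refl
  sumFin-neg (suc k) f =
    trans (cong (- f zero +_) (sumFin-neg k (f ∘ suc)))
          (sym (ℚP.neg-distrib-+ (f zero) (sumFin k (f ∘ suc))))

  *-distribˡ-sumFin : ∀ k x (f : Vector ℚ k) → x * sumFin k f ≡ sumFin k (λ i → x * f i)
  *-distribˡ-sumFin zero    x f = ℚP.*-zeroʳ x
  *-distribˡ-sumFin (suc k) x f =
    trans (ℚP.*-distribˡ-+ x (f zero) (sumFin k (f ∘ suc)))
          (cong (x * f zero +_) (*-distribˡ-sumFin k x (f ∘ suc)))

  *-distribʳ-sumFin : ∀ k x (f : Vector ℚ k) → sumFin k f * x ≡ sumFin k (λ i → f i * x)
  *-distribʳ-sumFin k x f =
    trans (ℚP.*-comm (sumFin k f) x)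
          (trans (*-distribˡ-sumFin k x f) (sumFin-cong k (λ i → ℚP.*-comm x (f i))))

  sumFin-comm : ∀ k l (f : Fin k → Fin l → ℚ) →
    sumFin k (λ i → sumFin l (f i)) ≡ sumFin l (λ j → sumFin k (λ i → f i j))
  sumFin-comm zero    l f = sym (sumFin-0 l (λ _ → refl))
  sumFin-comm (suc k) l f =
    trans (cong (sumFin l (f zero) +_) (sumFin-comm k l (f ∘ suc)))
          (sym (sumFin-distrib-+ l (f zero) (λ j → sumFin k (λ i → f (suc i) j))))

  sumFin-splitAt : ∀ a b (f : Vector ℚ (a ℕ.+ b)) →
    sumFin (a ℕ.+ b) f ≡ sumFin a (λ i → f (i ↑ˡ b)) + sumFin b (λ j → f (a ↑ʳ j))
  sumFin-splitAt zero    b f = sym (ℚP.+-identityˡ _)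
  sumFin-splitAt (suc a) b f =
    trans (cong (f zero +_) (sumFin-splitAt a b (f ∘ suc)))
          (sym (ℚP.+-assoc (f zero) _ _))

  sumFin-combine : ∀ a b (f : Vector ℚ (a ℕ.* b)) →
    sumFin (a ℕ.* b) f ≡ sumFin a (λ i → sumFin b (λ j → f (combine i j)))
  sumFin-combine zero    b f = refl
  sumFin-combine (suc a) b f =
    trans (sumFin-splitAt b (a ℕ.* b) f)
          (cong (sumFin b (λ j → f (j ↑ˡ (a ℕ.* b))) +_) (sumFin-combine a b (f ∘ (b ↑ʳ_))))

  sumFin-remove : ∀ k (t : Fin (suc k)) (f : Vector ℚ (suc k)) →
    sumFin (suc k) f ≡ f t + sumFin k (removeAt f t)
  sumFin-remove k       zero    f = refl
  sumFin-remove (suc k) (suc t) f =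
    trans (cong (f zero +_) (sumFin-remove k t (f ∘ suc)))
          (x∙yz≈y∙xz (f zero) (f (suc t)) (sumFin k (removeAt (f ∘ suc) t)))

  sumFin-linear : ∀ k (f g h : Vector ℚ k) x →
    sumFin k (λ i → f i * (g i * x + h i)) ≡ sumFin k (λ i → f i * g i) * x + sumFin k (λ i → f i * h i)
  sumFin-linear k f g h x = begin
    sumFin k (λ i → f i * (g i * x + h i))
      ≡⟨ sumFin-cong k (λ i → expand (f i) (g i) x (h i)) ⟩
    sumFin k (λ i → (f i * g i) * x + f i * h i)
      ≡⟨ sumFin-distrib-+ k (λ i → (f i * g i) * x) (λ i → f i * h i) ⟩
    sumFin k (λ i → (f i * g i) * x) + sumFin k (λ i → f i * h i)
      ≡⟨ cong (_+ sumFin k (λ i → f i * h i)) (*-distribʳ-sumFin k x (λ i → f i * g i)) ⟨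
    sumFin k (λ i → f i * g i) * x + sumFin k (λ i → f i * h i) ∎
    where
    open ≡-Reasoning
    expand : ∀ f g x h → f * (g * x + h) ≡ (f * g) * x + f * h
    expand = solve 4 (λ f g x h → f :* (g :* x :+ h) := (f :* g) :* x :+ f :* h) refl
open Sums

module KroneckerDelta where
  open Q using (_+_; _*_)

  idM-diag : (i : Fin k) → idM i i ≡ 1ℚ
  idM-diag i with i ≟ i
  ... | yes _   = refl
  ... | no  i≢i = ⊥-elim (i≢i refl)

  idM-offDiag : {i j : Fin k} → i ≢ j → idM i j ≡ 0ℚ
  idM-offDiag {i = i} {j} i≢j with i ≟ j
  ... | yes i≡j = ⊥-elim (i≢j i≡j)
  ... | no  _   = refl

  idM-sym : (i j : Fin k) → idM i j ≡ idM j i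
  idM-sym i j with i ≟ j
  ... | yes refl = sym (idM-diag i)
  ... | no  i≢j  = sym (idM-offDiag (i≢j ∘ sym))

  sumFin-idMˡ : ∀ k (i : Fin k) (f : Vector ℚ k) → sumFin k (λ j → idM i j * f j) ≡ f i
  sumFin-idMˡ (suc k) i f = begin
    sumFin (suc k) (λ j → idM i j * f j)
      ≡⟨ sumFin-remove k i (λ j → idM i j * f j) ⟩
    idM i i * f i + sumFin k (λ j → idM i (punchIn i j) * f (punchIn i j))
      ≡⟨ cong₂ _+_ (trans (cong (_* f i) (idM-diag i)) (ℚP.*-identityˡ (f i)))
                   (sumFin-0 k (λ j → trans (cong (_* f (punchIn i j)) (idM-offDiag (punchInᵢ≢i i j ∘ sym)))
                                            (ℚP.*-zeroˡ (f (punchIn i j))))) ⟩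
    f i + 0ℚ
      ≡⟨ ℚP.+-identityʳ (f i) ⟩
    f i ∎
    where open ≡-Reasoning

  sumFin-idMʳ : ∀ k (i : Fin k) (f : Vector ℚ k) → sumFin k (λ j → f j * idM j i) ≡ f i
  sumFin-idMʳ k i f =
    trans (sumFin-cong k (λ j → trans (ℚP.*-comm (f j) (idM j i)) (cong (_* f j) (idM-sym j i))))
          (sumFin-idMˡ k i f)

  idM-combine : (i j : Fin a) (x y : Fin b) → idM (combine i x) (combine j y) ≡ idM i j * idM x y
  idM-combine i j x y with i ≟ j
  ... | no i≢j = trans (idM-offDiag (i≢j ∘ combine-injectiveˡ i x j y)) (sym (ℚP.*-zeroˡ (idM x y)))
  ... | yes refl with x ≟ y
  ...   | yes refl = trans (idM-diag (combine i x)) (sym (ℚP.*-identityˡ 1ℚ))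
  ...   | no x≢y   = trans (idM-offDiag (x≢y ∘ combine-injectiveʳ i x i y)) (sym (ℚP.*-zeroʳ 1ℚ))

  unitM≡idM*idM : (j k x y : Fin a) → unitM j k x y ≡ idM x j * idM y k
  unitM≡idM*idM j k x y with x ≟ j | y ≟ k
  ... | yes _ | yes _ = sym (ℚP.*-identityˡ 1ℚ)
  ... | yes _ | no  _ = sym (ℚP.*-identityˡ 0ℚ)
  ... | no  _ | yes _ = sym (ℚP.*-zeroˡ 1ℚ)
  ... | no  _ | no  _ = sym (ℚP.*-zeroˡ 0ℚ)
  sumFin-unitM : ∀ d (f : Fin d → Fin d → ℚ) (b b′ : Fin d) →
    sumFin d (λ j → sumFin d (λ k → unitM j k b b′ * f j k)) ≡ f b b′
  sumFin-unitM d f b b′ = begin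
    sumFin d (λ j → sumFin d (λ k → unitM j k b b′ * f j k))
      ≡⟨ sumFin-cong d (λ j → sumFin-cong d (λ k →
           trans (cong (_* f j k) (unitM≡idM*idM j k b b′)) (ℚP.*-assoc (idM b j) (idM b′ k) (f j k)))) ⟩
    sumFin d (λ j → sumFin d (λ k → idM b j * (idM b′ k * f j k)))
      ≡⟨ sumFin-cong d (λ j → trans (sym (*-distribˡ-sumFin d (idM b j) (λ k → idM b′ k * f j k)))
                                    (cong (idM b j *_) (sumFin-idMˡ d b′ (f j)))) ⟩
    sumFin d (λ j → idM b j * f j b′)
      ≡⟨ sumFin-idMˡ d b (λ j → f j b′) ⟩
    f b b′ ∎
    where open ≡-Reasoning
open KroneckerDelta

module MatrixVector where
  open Q using (_+_; _*_; -_; _-_)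
  open +-*-Solver

  infixr 6 _·ᵥ_
  _·ᵥ_ : Mat a b → Vector ℚ b → Vector ℚ a
  _·ᵥ_ {b = b} M v i = sumFin b (λ j → M i j * v j)

  reshape : Vector ℚ (a ℕ.* b) → Mat a b
  reshape w i j = w (combine i j)

  single : Fin a → ℚ → Vector ℚ a
  single j₀ x j = idM j j₀ * x

  ·ᵥ-congʳ : (M : Mat a b) {v w : Vector ℚ b} → v ≗ w → M ·ᵥ v ≗ M ·ᵥ w
  ·ᵥ-congʳ {b = b} M v≗w i = sumFin-cong b (λ j → cong (M i j *_) (v≗w j))

  ·ᵥ-congˡ : {M N : Mat a b} → M ≐ N → (v : Vector ℚ b) → M ·ᵥ v ≗ N ·ᵥ v
  ·ᵥ-congˡ {b = b} M≐N v i = sumFin-cong b (λ j → cong (_* v j) (M≐N i j))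

  ·ᵥ-zero : (M : Mat a b) {v : Vector ℚ b} → IsZero v → IsZero (M ·ᵥ v)
  ·ᵥ-zero {b = b} M v≡0 i =
    sumFin-0 b (λ j → trans (cong (M i j *_) (v≡0 j)) (ℚP.*-zeroʳ (M i j)))

  ·ᵥ-distribˡ-+ : (M : Mat a b) (v w : Vector ℚ b) →
    M ·ᵥ (λ j → v j + w j) ≗ (λ i → (M ·ᵥ v) i + (M ·ᵥ w) i)
  ·ᵥ-distribˡ-+ {b = b} M v w i =
    trans (sumFin-cong b (λ j → ℚP.*-distribˡ-+ (M i j) (v j) (w j)))
          (sumFin-distrib-+ b (λ j → M i j * v j) (λ j → M i j * w j))

  ·ᵥ-neg : (M : Mat a b) (v : Vector ℚ b) → M ·ᵥ (λ j → - v j) ≗ (λ i → - (M ·ᵥ v) i)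
  ·ᵥ-neg {b = b} M v i =
    trans (sumFin-cong b (λ j → sym (ℚP.neg-distribʳ-* (M i j) (v j))))
          (sumFin-neg b (λ j → M i j * v j))

  ·ᵥ-sumFin : ∀ l (M : Mat a b) (f : Fin l → Vector ℚ b) →
    M ·ᵥ (λ j → sumFin l (λ t → f t j)) ≗ (λ i → sumFin l (λ t → (M ·ᵥ f t) i))
  ·ᵥ-sumFin {b = b} l M f i =
    trans (sumFin-cong b (λ j → *-distribˡ-sumFin l (M i j) (λ t → f t j)))
          (sumFin-comm b l (λ j t → M i j * f t j))

  ·ᵥ-distribʳ-⊕ : (M N : Mat a b) (v : Vector ℚ b) →
    (M ⊕ N) ·ᵥ v ≗ (λ i → (M ·ᵥ v) i + (N ·ᵥ v) i)
  ·ᵥ-distribʳ-⊕ {b = b} M N v i =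
    trans (sumFin-cong b (λ j → ℚP.*-distribʳ-+ (v j) (M i j) (N i j)))
          (sumFin-distrib-+ b (λ j → M i j * v j) (λ j → N i j * v j))

  negM-·ᵥ : (M : Mat a b) (v : Vector ℚ b) → negM M ·ᵥ v ≗ (λ i → - (M ·ᵥ v) i)
  negM-·ᵥ {b = b} M v i =
    trans (sumFin-cong b (λ j → sym (ℚP.neg-distribˡ-* (M i j) (v j))))
          (sumFin-neg b (λ j → M i j * v j))

  ⊖-·ᵥ : (M N : Mat a b) (v : Vector ℚ b) → (M ⊖ N) ·ᵥ v ≗ (λ i → (M ·ᵥ v) i - (N ·ᵥ v) i)
  ⊖-·ᵥ M N v i = trans (·ᵥ-distribʳ-⊕ M (negM N) v i) (cong ((M ·ᵥ v) i +_) (negM-·ᵥ N v i))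

  idM-·ᵥ : (v : Vector ℚ a) → idM ·ᵥ v ≗ v
  idM-·ᵥ {a = a} v i = sumFin-idMˡ a i v

  ·ᵥ-single : (M : Mat a b) (j₀ : Fin b) (x : ℚ) → M ·ᵥ single j₀ x ≗ (λ i → M i j₀ * x)
  ·ᵥ-single {b = b} M j₀ x i =
    trans (sumFin-cong b (λ j → rearrange (M i j) (idM j j₀) x)) (sumFin-idMʳ b j₀ (λ j → M i j * x))
    where
    rearrange : ∀ m δ x → m * (δ * x) ≡ (m * x) * δ
    rearrange = solve 3 (λ m δ x → m :* (δ :* x) := (m :* x) :* δ) refl

  ·ᵥ-assoc : (M : Mat a k) (N : Mat k b) (v : Vector ℚ b) → (M · N) ·ᵥ v ≗ M ·ᵥ (N ·ᵥ v)
  ·ᵥ-assoc {k = k} {b = b} M N v i = begin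
    sumFin b (λ j → sumFin k (λ t → M i t * N t j) * v j)
      ≡⟨ sumFin-cong b (λ j → trans (*-distribʳ-sumFin k (v j) (λ t → M i t * N t j))
                                    (sumFin-cong k (λ t → ℚP.*-assoc (M i t) (N t j) (v j)))) ⟩
    sumFin b (λ j → sumFin k (λ t → M i t * (N t j * v j)))
      ≡⟨ sumFin-comm b k (λ j t → M i t * (N t j * v j)) ⟩
    sumFin k (λ t → sumFin b (λ j → M i t * (N t j * v j)))
      ≡⟨ sumFin-cong k (λ t → sym (*-distribˡ-sumFin b (M i t) (λ j → N t j * v j))) ⟩
    (M ·ᵥ (N ·ᵥ v)) i ∎
    where open ≡-Reasoning

  sumMat-entry : ∀ l (F : Fin l → Mat a b) i j → sumMat l F i j ≡ sumFin l (λ t → F t i j)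
  sumMat-entry zero    F i j = refl
  sumMat-entry (suc l) F i j = cong (F zero i j +_) (sumMat-entry l (F ∘ suc) i j)

  sumMat-·ᵥ : ∀ l (F : Fin l → Mat a b) (v : Vector ℚ b) →
    sumMat l F ·ᵥ v ≗ (λ i → sumFin l (λ t → (F t ·ᵥ v) i))
  sumMat-·ᵥ {b = b} l F v i = begin
    sumFin b (λ j → sumMat l F i j * v j)
      ≡⟨ sumFin-cong b (λ j → trans (cong (_* v j) (sumMat-entry l F i j))
                                    (*-distribʳ-sumFin l (v j) (λ t → F t i j))) ⟩
    sumFin b (λ j → sumFin l (λ t → F t i j * v j))
      ≡⟨ sumFin-comm b l (λ j t → F t i j * v j) ⟩
    sumFin l (λ t → (F t ·ᵥ v) i) ∎
    where open ≡-Reasoning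

  ⊗-entry : (M : Mat a b) (P : Mat c e) → ∀ i x j y →
    (M ⊗ P) (combine i x) (combine j y) ≡ M i j * P x y
  ⊗-entry {a = a} {b} {c} {e} M P i x j y =
    cong₂ (λ r r′ → M (proj₁ r) (proj₁ r′) * P (proj₂ r) (proj₂ r′))
          (remQuot-combine {a} {c} i x) (remQuot-combine {b} {e} j y)

  ·-assoc : (A : Mat a b) (B : Mat b c) (C : Mat c k) → ((A · B) · C) ≐ (A · (B · C))
  ·-assoc A B C i x = ·ᵥ-assoc A B (λ t → C t x) i

  ·-congˡ : {A A′ : Mat a b} → A ≐ A′ → (B : Mat b c) → (A · B) ≐ (A′ · B)
  ·-congˡ A≐A′ B i x = ·ᵥ-congˡ A≐A′ (λ t → B t x) i

  ·-congʳ : (A : Mat a b) {B B′ : Mat b c} → B ≐ B′ → (A · B) ≐ (A · B′)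
  ·-congʳ A B≐B′ i x = ·ᵥ-congʳ A (λ t → B≐B′ t x) i

  transpose : Mat a b → Mat b a
  transpose M i j = M j i

  ⊗-·ᵥ : (M : Mat a b) (P : Mat c e) (w : Vector ℚ (b ℕ.* e)) → ∀ α x →
    ((M ⊗ P) ·ᵥ w) (combine α x) ≡ (M · (reshape w · transpose P)) α x
  ⊗-·ᵥ {b = b} {e = e} M P w α x = begin
    sumFin (b ℕ.* e) (λ J → (M ⊗ P) (combine α x) J * w J)
      ≡⟨ sumFin-combine b e _ ⟩
    sumFin b (λ β → sumFin e (λ y → (M ⊗ P) (combine α x) (combine β y) * w (combine β y)))
      ≡⟨ sumFin-cong b (λ β → sumFin-cong e (λ y →
           trans (cong (_* w (combine β y)) (⊗-entry M P α x β y))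
                 (rearrange (M α β) (P x y) (w (combine β y))))) ⟩
    sumFin b (λ β → sumFin e (λ y → M α β * (w (combine β y) * P x y)))
      ≡⟨ sumFin-cong b (λ β → sym (*-distribˡ-sumFin e (M α β) (λ y → w (combine β y) * P x y))) ⟩
    (M · (reshape w · transpose P)) α x ∎
    where
    open ≡-Reasoning
    rearrange : ∀ m p w → (m * p) * w ≡ m * (w * p)
    rearrange = solve 3 (λ m p w → (m :* p) :* w := m :* (w :* p)) refl

  ⊗idM-·ᵥ : (M : Mat a b) (w : Vector ℚ (b ℕ.* e)) → ∀ α x →
    ((M ⊗ idM) ·ᵥ w) (combine α x) ≡ (M · reshape w) α x
  ⊗idM-·ᵥ {e = e} M w α x =
    trans (⊗-·ᵥ M idM w α x) (·ᵥ-congʳ M (λ β →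
      trans (sumFin-cong e (λ y → cong (w (combine β y) *_) (idM-sym x y)))
            (sumFin-idMʳ e x (reshape w β))) α)

  leftInverse-solve : (N : Mat b a) (P : Mat a b) → (N · P) ≐ idM →
    (u : Vector ℚ b) (z : Vector ℚ a) → P ·ᵥ u ≗ z → u ≗ N ·ᵥ z
  leftInverse-solve N P NP≐I u z Pu≗z i = begin
    u i                ≡⟨ sym (idM-·ᵥ u i) ⟩
    (idM ·ᵥ u) i       ≡⟨ ·ᵥ-congˡ NP≐I u i ⟨
    ((N · P) ·ᵥ u) i   ≡⟨ ·ᵥ-assoc N P u i ⟩
    (N ·ᵥ (P ·ᵥ u)) i  ≡⟨ ·ᵥ-congʳ N Pu≗z i ⟩
    (N ·ᵥ z) i         ∎
    where open ≡-Reasoning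
open MatrixVector

module Rank where
  open Q using (_+_; _*_; -_; _-_)
  open +-*-Solver

  TrivialKernel : Mat a b → Set
  TrivialKernel M = ∀ v → IsZero (M ·ᵥ v) → IsZero v

  columns : Mat a b → (Fin k → Fin b) → Mat a k
  columns M f i t = M i (f t)

  p*x≡0⇒x≡0 : {p x : ℚ} → p ≢ 0ℚ → p * x ≡ 0ℚ → x ≡ 0ℚ
  p*x≡0⇒x≡0 {p} {x} p≢0 px≡0 = begin
    x                ≡⟨ ℚP.*-identityˡ x ⟨
    1ℚ * x           ≡⟨ cong (_* x) (ℚP.*-inverseˡ p) ⟨
    (1/ p * p) * x   ≡⟨ ℚP.*-assoc (1/ p) p x ⟩
    1/ p * (p * x)   ≡⟨ cong (1/ p *_) px≡0 ⟩
    1/ p * 0ℚ        ≡⟨ ℚP.*-zeroʳ (1/ p) ⟩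
    0ℚ               ∎
    where
    open ≡-Reasoning
    instance
      p-nonZero : NonZero p
      p-nonZero = ≢-nonZero p≢0

  RankAtLeast-submatrix : {M : Mat a b} {M′ : Mat c l} (σ : Fin c → Fin a) (τ : Fin l → Fin b) →
    (∀ i j → M′ i j ≡ M (σ i) (τ j)) → RankAtLeast M′ k → RankAtLeast M k
  RankAtLeast-submatrix {k = k} σ τ M′≡M (f , ker) =
    τ ∘ f , λ v Mv≡0 → ker v (λ i →
      trans (sumFin-cong k (λ t → cong (_* v t) (M′≡M i (f t)))) (Mv≡0 (σ i)))

  module Pivot {a b} (M : Mat a (suc b)) (i₀ : Fin a) (j₀ : Fin (suc b)) (M≢0 : M i₀ j₀ ≢ 0ℚ) where
    private instance
      pivot-nonZero : NonZero (M i₀ j₀)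
      pivot-nonZero = ≢-nonZero M≢0

    ratio : Vector ℚ a
    ratio i = M i j₀ * 1/ M i₀ j₀

    others : Mat a b
    others i j = M i (punchIn j₀ j)

    reduced : Mat a b
    reduced i j = others i j - ratio i * others i₀ j

    ratio*pivot : ∀ i → ratio i * M i₀ j₀ ≡ M i j₀
    ratio*pivot i = begin
      (M i j₀ * 1/ M i₀ j₀) * M i₀ j₀  ≡⟨ ℚP.*-assoc (M i j₀) (1/ M i₀ j₀) (M i₀ j₀) ⟩
      M i j₀ * (1/ M i₀ j₀ * M i₀ j₀)  ≡⟨ cong (M i j₀ *_) (ℚP.*-inverseˡ (M i₀ j₀)) ⟩
      M i j₀ * 1ℚ                      ≡⟨ ℚP.*-identityʳ (M i j₀) ⟩
      M i j₀                           ∎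
      where open ≡-Reasoning

    M-·ᵥ : ∀ v i → (M ·ᵥ v) i ≡ M i j₀ * v j₀ + (others ·ᵥ removeAt v j₀) i
    M-·ᵥ v i = sumFin-remove b j₀ (λ j → M i j * v j)

    reduced-·ᵥ : ∀ u i → (reduced ·ᵥ u) i ≡ (others ·ᵥ u) i - ratio i * (others ·ᵥ u) i₀
    reduced-·ᵥ u i = begin
      sumFin b (λ j → (others i j - ratio i * others i₀ j) * u j)
        ≡⟨ sumFin-cong b (λ j → expand (others i j) (ratio i) (others i₀ j) (u j)) ⟩
      sumFin b (λ j → others i j * u j + - (ratio i * (others i₀ j * u j)))
        ≡⟨ sumFin-distrib-+ b _ _ ⟩
      (others ·ᵥ u) i + sumFin b (λ j → - (ratio i * (others i₀ j * u j)))
        ≡⟨ cong ((others ·ᵥ u) i +_) (trans (sumFin-neg b _) (cong -_ (sym (*-distribˡ-sumFin b (ratio i) _)))) ⟩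
      (others ·ᵥ u) i - ratio i * (others ·ᵥ u) i₀ ∎
      where
      open ≡-Reasoning
      expand : ∀ x r y z → (x - r * y) * z ≡ x * z + - (r * (y * z))
      expand = solve 4 (λ x r y z → (x :- r :* y) :* z := x :* z :+ (:- (r :* (y :* z)))) refl

    ·ᵥ-reduced : ∀ v i → (M ·ᵥ v) i ≡ (reduced ·ᵥ removeAt v j₀) i + ratio i * (M ·ᵥ v) i₀
    ·ᵥ-reduced v i = begin
      (M ·ᵥ v) i
        ≡⟨ M-·ᵥ v i ⟩
      M i j₀ * v j₀ + rest i
        ≡⟨ cong (λ m → m * v j₀ + rest i) (ratio*pivot i) ⟨
      (ratio i * M i₀ j₀) * v j₀ + rest i
        ≡⟨ regroup (ratio i) (M i₀ j₀) (v j₀) (rest i) (rest i₀) ⟩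
      (rest i - ratio i * rest i₀) + ratio i * (M i₀ j₀ * v j₀ + rest i₀)
        ≡⟨ cong₂ (λ x y → x + ratio i * y) (reduced-·ᵥ (removeAt v j₀) i) (M-·ᵥ v i₀) ⟨
      (reduced ·ᵥ removeAt v j₀) i + ratio i * (M ·ᵥ v) i₀ ∎
      where
      open ≡-Reasoning
      rest : Vector ℚ a
      rest = others ·ᵥ removeAt v j₀
      regroup : ∀ r π x s s₀ → (r * π) * x + s ≡ (s - r * s₀) + r * (π * x + s₀)
      regroup = solve 5 (λ r π x s s₀ → (r :* π) :* x :+ s := (s :- r :* s₀) :+ r :* (π :* x :+ s₀)) refl

    kernel-reduced : ∀ {v} → IsZero (M ·ᵥ v) → IsZero (reduced ·ᵥ removeAt v j₀)
    kernel-reduced {v} Mv≡0 i = begin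
      red i                          ≡⟨ ℚP.+-identityʳ (red i) ⟨
      red i + 0ℚ                     ≡⟨ cong (red i +_) (trans (cong (ratio i *_) (Mv≡0 i₀)) (ℚP.*-zeroʳ (ratio i))) ⟨
      red i + ratio i * (M ·ᵥ v) i₀  ≡⟨ ·ᵥ-reduced v i ⟨
      (M ·ᵥ v) i                     ≡⟨ Mv≡0 i ⟩
      0ℚ                             ∎
      where
      open ≡-Reasoning
      red : Vector ℚ a
      red = reduced ·ᵥ removeAt v j₀

    kernel-from-reduced : ∀ {v} → IsZero (reduced ·ᵥ removeAt v j₀) → (M ·ᵥ v) i₀ ≡ 0ℚ → IsZero (M ·ᵥ v)
    kernel-from-reduced {v} red≡0 Mv₀≡0 i = begin
      (M ·ᵥ v) i                                            ≡⟨ ·ᵥ-reduced v i ⟩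
      (reduced ·ᵥ removeAt v j₀) i + ratio i * (M ·ᵥ v) i₀  ≡⟨ cong₂ (λ x y → x + ratio i * y) (red≡0 i) Mv₀≡0 ⟩
      0ℚ + ratio i * 0ℚ                                     ≡⟨ trans (ℚP.+-identityˡ _) (ℚP.*-zeroʳ (ratio i)) ⟩
      0ℚ                                                    ∎
      where open ≡-Reasoning

    trivialKernel-from-reduced : TrivialKernel reduced → TrivialKernel M
    trivialKernel-from-reduced ker v Mv≡0 = v≡0
      where
      open ≡-Reasoning
      rest≡0 : IsZero (removeAt v j₀)
      rest≡0 = ker (removeAt v j₀) (kernel-reduced {v} Mv≡0)
      pivot-entry : v j₀ ≡ 0ℚ
      pivot-entry = p*x≡0⇒x≡0 M≢0 (begin
        M i₀ j₀ * v j₀                                 ≡⟨ ℚP.+-identityʳ (M i₀ j₀ * v j₀) ⟨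
        M i₀ j₀ * v j₀ + 0ℚ                            ≡⟨ cong (M i₀ j₀ * v j₀ +_) (·ᵥ-zero others rest≡0 i₀) ⟨
        M i₀ j₀ * v j₀ + (others ·ᵥ removeAt v j₀) i₀  ≡⟨ M-·ᵥ v i₀ ⟨
        (M ·ᵥ v) i₀                                    ≡⟨ Mv≡0 i₀ ⟩
        0ℚ                                             ∎)
      v≡0 : IsZero v
      v≡0 t with t ≟ j₀
      ... | yes refl = pivot-entry
      ... | no t≢j₀  = trans (cong v (sym (punchIn-punchOut (t≢j₀ ∘ sym))))
                             (rest≡0 (punchOut (t≢j₀ ∘ sym)))

  -- reducedH subtracts multiples of column 0 of H from the other columns so that row i₀ of
  -- M · H vanishes off column 0, and drops row j₀, which reduced no longer reads.
  module PivotProduct {a b k} (M : Mat a (suc b)) (H : Mat (suc b) (suc k)) {i₀ j₀}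
                      (M≢0 : M i₀ j₀ ≢ 0ℚ) (MH≢0 : (M · H) i₀ zero ≢ 0ℚ) where
    open Pivot M i₀ j₀ M≢0 public

    private
      X : Vector ℚ (suc k)
      X = (M · H) i₀
      instance
        X₀-nonZero : NonZero (X zero)
        X₀-nonZero = ≢-nonZero MH≢0

    μ : Vector ℚ k
    μ t = X (suc t) * 1/ X zero

    reducedH : Mat b k
    reducedH s t = H (punchIn j₀ s) (suc t) - μ t * H (punchIn j₀ s) zero

    lift : Vector ℚ k → Vector ℚ (suc k)
    lift c = (- sumFin k (λ t → μ t * c t)) ∷ c

    reducedH-·ᵥ : (c : Vector ℚ k) → reducedH ·ᵥ c ≗ removeAt (H ·ᵥ lift c) j₀
    reducedH-·ᵥ c s = begin
      sumFin k (λ t → (h (suc t) - μ t * h zero) * c t)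
        ≡⟨ sumFin-cong k (λ t → expand (h (suc t)) (μ t) (h zero) (c t)) ⟩
      sumFin k (λ t → h (suc t) * c t + h zero * - (μ t * c t))
        ≡⟨ sumFin-distrib-+ k _ _ ⟩
      sumFin k (λ t → h (suc t) * c t) + sumFin k (λ t → h zero * - (μ t * c t))
        ≡⟨ cong (sumFin k (λ t → h (suc t) * c t) +_)
                (trans (sym (*-distribˡ-sumFin k (h zero) _)) (cong (h zero *_) (sumFin-neg k _))) ⟩
      sumFin k (λ t → h (suc t) * c t) + h zero * lift c zero
        ≡⟨ ℚP.+-comm (sumFin k (λ t → h (suc t) * c t)) (h zero * lift c zero) ⟩
      (H ·ᵥ lift c) (punchIn j₀ s) ∎
      where
      open ≡-Reasoning
      h : Vector ℚ (suc k)
      h = H (punchIn j₀ s)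
      expand : ∀ x m y z → (x - m * y) * z ≡ x * z + y * - (m * z)
      expand = solve 4 (λ x m y z → (x :- m :* y) :* z := x :* z :+ y :* (:- (m :* z))) refl

    lift-annihilates-row : (c : Vector ℚ k) → ((M · H) ·ᵥ lift c) i₀ ≡ 0ℚ
    lift-annihilates-row c = begin
      X zero * - S + sumFin k (λ t → X (suc t) * c t)
        ≡⟨ cong (X zero * - S +_) (sumFin-cong k (λ t → cong (_* c t) (sym (X₀*μ t)))) ⟩
      X zero * - S + sumFin k (λ t → (X zero * μ t) * c t)
        ≡⟨ cong (X zero * - S +_) (trans (sumFin-cong k (λ t → ℚP.*-assoc (X zero) (μ t) (c t)))
                                         (sym (*-distribˡ-sumFin k (X zero) (λ t → μ t * c t)))) ⟩
      X zero * - S + X zero * S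
        ≡⟨ cancel (X zero) S ⟩
      0ℚ ∎
      where
      open ≡-Reasoning
      S : ℚ
      S = sumFin k (λ t → μ t * c t)
      X₀*μ : ∀ t → X zero * μ t ≡ X (suc t)
      X₀*μ t = trans (ℚP.*-comm (X zero) (μ t))
        (trans (ℚP.*-assoc (X (suc t)) (1/ X zero) (X zero))
          (trans (cong (X (suc t) *_) (ℚP.*-inverseˡ (X zero))) (ℚP.*-identityʳ (X (suc t)))))
      cancel : ∀ x s → x * - s + x * s ≡ 0ℚ
      cancel = solve 2 (λ x s → x :* (:- s) :+ x :* s := con 0ℚ) refl

    trivialKernel-reduced : TrivialKernel (M · H) → TrivialKernel (reduced · reducedH)
    trivialKernel-reduced ker c RHc≡0 t = lift≡0 (suc t)
      where
      w : Vector ℚ (suc b)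
      w = H ·ᵥ lift c
      reduced-w≡0 : IsZero (reduced ·ᵥ removeAt w j₀)
      reduced-w≡0 i = begin
        (reduced ·ᵥ removeAt w j₀) i   ≡⟨ ·ᵥ-congʳ reduced (reducedH-·ᵥ c) i ⟨
        (reduced ·ᵥ reducedH ·ᵥ c) i   ≡⟨ ·ᵥ-assoc reduced reducedH c i ⟨
        ((reduced · reducedH) ·ᵥ c) i  ≡⟨ RHc≡0 i ⟩
        0ℚ                             ∎
        where open ≡-Reasoning
      Mw≡0 : IsZero (M ·ᵥ w)
      Mw≡0 = kernel-from-reduced {w} reduced-w≡0
               (trans (sym (·ᵥ-assoc M H (lift c) i₀)) (lift-annihilates-row c))
      lift≡0 : IsZero (lift c)
      lift≡0 = ker (lift c) (λ i → trans (·ᵥ-assoc M H (lift c) i) (Mw≡0 i))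

  nonzero-in-column : (P : Mat a k) → TrivialKernel P → (t : Fin k) → ∃ λ i → P i t ≢ 0ℚ
  nonzero-in-column {a = a} {k = k} P ker t =
    ¬∀⟶∃¬ a (λ i → P i t ≡ 0ℚ) (λ i → P i t ℚP.≟ 0ℚ) column≢0
    where
    column≢0 : ¬ IsZero (λ i → P i t)
    column≢0 Pt≡0 = 1≢0 (trans (sym (idM-diag t)) (ker (λ s → idM s t) Pet≡0 t))
      where
      1≢0 : 1ℚ ≢ 0ℚ
      1≢0 ()
      Pet≡0 : IsZero (P ·ᵥ (λ s → idM s t))
      Pet≡0 i = trans (sumFin-idMʳ k t (P i)) (Pt≡0 i)

  nonzero-factor : (M : Mat a b) (H : Mat b k) {i : Fin a} {t : Fin k} →
    (M · H) i t ≢ 0ℚ → ∃ λ j → M i j ≢ 0ℚ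
  nonzero-factor {b = b} M H {i} {t} MH≢0 =
    ¬∀⟶∃¬ b (λ j → M i j ≡ 0ℚ) (λ j → M i j ℚP.≟ 0ℚ) (λ row≡0 →
      MH≢0 (sumFin-0 b (λ j → trans (cong (_* H j t) (row≡0 j)) (ℚP.*-zeroˡ (H j t)))))

  -- Pivot on some M i₀ j₀ ≢ 0 in a row where column 0 of M · H is nonzero, and recurse on the
  -- reduced M and H; the pivot column j₀ joins the columns found recursively.
  rankAtLeast-of-product : ∀ k (M : Mat a b) (H : Mat b k) → TrivialKernel (M · H) → RankAtLeast M k
  rankAtLeast-of-product zero M H _ = (λ ()) , (λ _ _ ())
  rankAtLeast-of-product {a = a} (suc k) M H ker =
    let i₀ , MH≢0 = nonzero-in-column (M · H) ker zero
        j₀ , M≢0  = nonzero-factor M H MH≢0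
    in extend M H ker j₀ M≢0 MH≢0
    where
    extend : ∀ {b} (M : Mat a b) (H : Mat b (suc k)) → TrivialKernel (M · H) →
      ∀ {i₀} (j₀ : Fin b) → M i₀ j₀ ≢ 0ℚ → (M · H) i₀ zero ≢ 0ℚ → RankAtLeast M (suc k)
    extend {suc b} M H ker {i₀} j₀ M≢0 MH≢0 =
      let f , ker′ = rankAtLeast-of-product k reduced reducedH (trivialKernel-reduced ker)
      in (j₀ ∷ punchIn j₀ ∘ f) ,
         Pivot.trivialKernel-from-reduced (columns M (j₀ ∷ punchIn j₀ ∘ f)) i₀ zero M≢0 ker′
      where open PivotProduct M H M≢0 MH≢0
open Rank

module SchurComplement where
  open Q using (_+_; _*_; -_; _-_)

  -- Eliminating u = − N Q (x e_J₀) leaves (S − R N Q) (x e_J₀) = 0.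
  schur-columns-independent :
    (P : Mat p p) (Q : Mat p m) (R : Mat m p) (S : Mat m m) {N : Mat p p} → (N · P) ≐ idM →
    {I₀ J₀ : Fin m} → (S ⊖ (R · N · Q)) I₀ J₀ ≢ 0ℚ →
    (u : Vector ℚ p) (x : ℚ) →
    IsZero (λ i → (P ·ᵥ u) i + (Q ·ᵥ single J₀ x) i) →
    IsZero (λ j → (R ·ᵥ u) j + (S ·ᵥ single J₀ x) j) →
    x ≡ 0ℚ × IsZero u
  schur-columns-independent {m = m} P Q R S {N} NP≐I {I₀} {J₀} schur≢0 u x top≡0 bottom≡0 = x≡0 , u≡0
    where
    open ≡-Reasoning
    w : Vector ℚ m
    w = single J₀ x
    u≗-NQw : u ≗ (λ i → - (N ·ᵥ Q ·ᵥ w) i)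
    u≗-NQw i =
      trans (leftInverse-solve N P NP≐I u (λ i → - (Q ·ᵥ w) i) (λ i → inverseˡ-unique _ _ (top≡0 i)) i)
            (·ᵥ-neg N (Q ·ᵥ w) i)
    schur-w≡0 : IsZero ((S ⊖ (R · N · Q)) ·ᵥ w)
    schur-w≡0 j = begin
      ((S ⊖ (R · N · Q)) ·ᵥ w) j
        ≡⟨ ⊖-·ᵥ S (R · N · Q) w j ⟩
      (S ·ᵥ w) j - ((R · N · Q) ·ᵥ w) j
        ≡⟨ cong (λ z → (S ·ᵥ w) j - z) (trans (·ᵥ-assoc (R · N) Q w j) (·ᵥ-assoc R N (Q ·ᵥ w) j)) ⟩
      (S ·ᵥ w) j - (R ·ᵥ N ·ᵥ Q ·ᵥ w) j
        ≡⟨ cong ((S ·ᵥ w) j +_) (trans (·ᵥ-congʳ R u≗-NQw j) (·ᵥ-neg R (N ·ᵥ Q ·ᵥ w) j)) ⟨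
      (S ·ᵥ w) j + (R ·ᵥ u) j
        ≡⟨ ℚP.+-comm ((S ·ᵥ w) j) ((R ·ᵥ u) j) ⟩
      (R ·ᵥ u) j + (S ·ᵥ w) j
        ≡⟨ bottom≡0 j ⟩
      0ℚ ∎
    x≡0 : x ≡ 0ℚ
    x≡0 = p*x≡0⇒x≡0 schur≢0 (trans (sym (·ᵥ-single (S ⊖ (R · N · Q)) J₀ x I₀)) (schur-w≡0 I₀))
    w≡0 : IsZero w
    w≡0 j = trans (cong (idM j J₀ *_) x≡0) (ℚP.*-zeroʳ (idM j J₀))
    u≡0 : IsZero u
    u≡0 i = trans (u≗-NQw i) (cong -_ (·ᵥ-zero N (·ᵥ-zero Q w≡0) i))
open SchurComplement

module LinearMatrices where
  open Q using (_+_; _*_; -_; _-_)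
  open +-*-Solver

  Subst : ℕ → ℕ → ℕ → Set
  Subst n d e = Fin n → Fin d → Fin d → Mat e e

  sumVars : (Fin n → Fin d → Fin d → ℚ) → ℚ
  sumVars {n = n} {d = d} f = sumFin n (λ i → sumFin d (λ j → sumFin d (λ k → f i j k)))

  sumVars-cong : {f g : Fin n → Fin d → Fin d → ℚ} → (∀ i j k → f i j k ≡ g i j k) → sumVars f ≡ sumVars g
  sumVars-cong {n = n} {d = d} f≡g = sumFin-cong n (λ i → sumFin-cong d (λ j → sumFin-cong d (f≡g i j)))

  sumVars-distrib-+ : (f g : Fin n → Fin d → Fin d → ℚ) →
    sumVars (λ i j k → f i j k + g i j k) ≡ sumVars f + sumVars g
  sumVars-distrib-+ {n = n} {d = d} f g =
    trans (sumFin-cong n (λ i →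
             trans (sumFin-cong d (λ j → sumFin-distrib-+ d (f i j) (g i j)))
                   (sumFin-distrib-+ d (λ j → sumFin d (f i j)) (λ j → sumFin d (g i j)))))
          (sumFin-distrib-+ n (λ i → sumFin d (λ j → sumFin d (f i j)))
                              (λ i → sumFin d (λ j → sumFin d (g i j))))

  sumVars-neg : (f : Fin n → Fin d → Fin d → ℚ) → sumVars (λ i j k → - f i j k) ≡ - sumVars f
  sumVars-neg {n = n} {d = d} f =
    trans (sumFin-cong n (λ i →
             trans (sumFin-cong d (λ j → sumFin-neg d (f i j)))
                   (sumFin-neg d (λ j → sumFin d (f i j)))))
          (sumFin-neg n (λ i → sumFin d (λ j → sumFin d (f i j))))

  ·ᵥ-sumVars : (M : Mat a b) (f : Fin n → Fin d → Fin d → Vector ℚ b) →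
    M ·ᵥ (λ β → sumVars (λ i j k → f i j k β)) ≗ (λ α → sumVars (λ i j k → (M ·ᵥ f i j k) α))
  ·ᵥ-sumVars {n = n} {d = d} M f α =
    trans (·ᵥ-sumFin n M (λ i β → sumFin d (λ j → sumFin d (λ k → f i j k β))) α)
          (sumFin-cong n (λ i →
             trans (·ᵥ-sumFin d M (λ j β → sumFin d (λ k → f i j k β)) α)
                   (sumFin-cong d (λ j → ·ᵥ-sumFin d M (λ k β → f i j k β) α))))

  sumMatVars : (Fin n → Fin d → Fin d → Mat a b) → Mat a b
  sumMatVars {n = n} {d = d} F = sumMat n (λ i → sumMat d (λ j → sumMat d (F i j)))

  sumMatVars-·ᵥ : (F : Fin n → Fin d → Fin d → Mat a b) (w : Vector ℚ b) →
    sumMatVars F ·ᵥ w ≗ (λ α → sumVars (λ i j k → (F i j k ·ᵥ w) α))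
  sumMatVars-·ᵥ {n = n} {d = d} F w α =
    trans (sumMat-·ᵥ n (λ i → sumMat d (λ j → sumMat d (F i j))) w α) (sumFin-cong n (λ i →
      trans (sumMat-·ᵥ d (λ j → sumMat d (F i j)) w α) (sumFin-cong d (λ j →
        sumMat-·ᵥ d (F i j) w α))))

  sumMatVars-entry : (F : Fin n → Fin d → Fin d → Mat a b) → ∀ I J →
    sumMatVars F I J ≡ sumVars (λ i j k → F i j k I J)
  sumMatVars-entry {n = n} {d = d} F I J =
    trans (sumMat-entry n (λ i → sumMat d (λ j → sumMat d (F i j))) I J) (sumFin-cong n (λ i →
      trans (sumMat-entry d (λ j → sumMat d (F i j)) I J) (sumFin-cong d (λ j →
        sumMat-entry d (F i j) I J))))

  -- evalLin K q acting on vec W (see evalLin-·ᵥ), computed without Kronecker products.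
  act : LinMat n d a b → Subst n d e → Mat b e → Mat a e
  act K q W α x = (const K · W) α x + sumVars (λ i j k → (coeff K i j k · (W · transpose (q i j k))) α x)

  evalLin-·ᵥ : (K : LinMat n d a b) (q : Subst n d e) (w : Vector ℚ (b ℕ.* e)) → ∀ α x →
    (evalLin K q ·ᵥ w) (combine α x) ≡ act K q (reshape w) α x
  evalLin-·ᵥ {n = n} {d = d} {a = a} {b = b} {e = e} K q w α x = begin
    (evalLin K q ·ᵥ w) (combine α x)
      ≡⟨ ·ᵥ-distribʳ-⊕ (const K ⊗ idM) (sumMatVars F) w (combine α x) ⟩
    ((const K ⊗ idM) ·ᵥ w) (combine α x) + (sumMatVars F ·ᵥ w) (combine α x)
      ≡⟨ cong (((const K ⊗ idM) ·ᵥ w) (combine α x) +_) (sumMatVars-·ᵥ F w (combine α x)) ⟩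
    ((const K ⊗ idM) ·ᵥ w) (combine α x) + sumVars (λ i j k → (F i j k ·ᵥ w) (combine α x))
      ≡⟨ cong₂ _+_ (⊗idM-·ᵥ (const K) w α x)
                   (sumVars-cong (λ i j k → ⊗-·ᵥ (coeff K i j k) (q i j k) w α x)) ⟩
    act K q (reshape w) α x ∎
    where
    open ≡-Reasoning
    F : Fin n → Fin d → Fin d → Mat (a ℕ.* e) (b ℕ.* e)
    F i j k = coeff K i j k ⊗ q i j k

  act-cong≋ : {K K′ : LinMat n d a b} (q : Subst n d e) → K ≋ K′ → ∀ W α x → act K q W α x ≡ act K′ q W α x
  act-cong≋ q (const≐ , coeff≐) W α x =
    cong₂ _+_ (·-congˡ const≐ W α x)
              (sumVars-cong (λ i j k → ·-congˡ (coeff≐ i j k) (W · transpose (q i j k)) α x))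

  act-congʳ : (K : LinMat n d a b) (q : Subst n d e) {W W′ : Mat b e} → W ≐ W′ → ∀ α x →
    act K q W α x ≡ act K q W′ α x
  act-congʳ K q W≐W′ α x =
    cong₂ _+_ (·-congʳ (const K) W≐W′ α x)
              (sumVars-cong (λ i j k →
                 ·-congʳ (coeff K i j k) (·-congˡ W≐W′ (transpose (q i j k))) α x))

  act-sandwich : (U : Mat a c) (K : LinMat n d c l) (V : Mat l b) (q : Subst n d e) (W : Mat b e) →
    ∀ α x → act (sandwich U K V) q W α x ≡ (U · act K q (V · W)) α x
  act-sandwich {c = c} {n = n} {d = d} {l = l} {b = b} {e = e} U K V q W α x = begin
    act (sandwich U K V) q W α x
      ≡⟨ cong₂ _+_ (reassoc (const K) W)
                   (sumVars-cong (λ i j k → trans (reassoc (coeff K i j k) (W · transpose (q i j k)))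
                                                  (·-congʳ U (·-congʳ (coeff K i j k) (V-assoc i j k)) α x))) ⟩
    (U · (const K · (V · W))) α x + sumVars (λ i j k → (U · Y i j k) α x)
      ≡⟨ cong ((U · (const K · (V · W))) α x +_) (·ᵥ-sumVars U (λ i j k γ → Y i j k γ x) α) ⟨
    (U · (const K · (V · W))) α x + (U ·ᵥ (λ γ → sumVars (λ i j k → Y i j k γ x))) α
      ≡⟨ ·ᵥ-distribˡ-+ U (λ γ → (const K · (V · W)) γ x) (λ γ → sumVars (λ i j k → Y i j k γ x)) α ⟨
    (U · act K q (V · W)) α x ∎
    where
    open ≡-Reasoning
    Y : Fin n → Fin d → Fin d → Mat c e
    Y i j k = coeff K i j k · ((V · W) · transpose (q i j k))
    V-assoc : ∀ i j k → (V · (W · transpose (q i j k))) ≐ ((V · W) · transpose (q i j k))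
    V-assoc i j k γ y = sym (·-assoc V W (transpose (q i j k)) γ y)
    reassoc : (M : Mat c l) (Z : Mat b e) → ((U · M · V) · Z) α x ≡ (U · (M · (V · Z))) α x
    reassoc M Z = trans (·-assoc (U · M) V Z α x) (·-assoc U M (V · Z) α x)

  act-idMinus : (L : LinMat n d a a) (q : Subst n d e) (W : Mat a e) → ∀ α x →
    act (idMinus L) q W α x ≡ W α x - act L q W α x
  act-idMinus L q W α x = begin
    act (idMinus L) q W α x
      ≡⟨ cong₂ _+_ (trans (⊖-·ᵥ idM (const L) (λ β → W β x) α) (cong (_- (const L · W) α x) (idM-·ᵥ (λ β → W β x) α)))
                   (trans (sumVars-cong (λ i j k → negM-·ᵥ (coeff L i j k) (λ β → (W · transpose (q i j k)) β x) α))
                          (sumVars-neg (λ i j k → (coeff L i j k · (W · transpose (q i j k))) α x))) ⟩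
    (W α x - (const L · W) α x) + - sumVars (λ i j k → (coeff L i j k · (W · transpose (q i j k))) α x)
      ≡⟨ regroup (W α x) _ _ ⟩
    W α x - act L q W α x ∎
    where
    open ≡-Reasoning
    regroup : ∀ w y z → (w - y) + - z ≡ w - (y + z)
    regroup = solve 3 (λ w y z → (w :- y) :+ (:- z) := w :- (y :+ z)) refl

  record RowSplit {a b c k} (A : Mat a (b ℕ.+ c)) (B : Mat k b) (C : Mat k c) (α : Fin a) (α′ : Fin k) : Set where
    constructor rowSplit
    field
      left  : ∀ β → A α (β ↑ˡ c) ≡ B α′ β
      right : ∀ γ → A α (b ↑ʳ γ) ≡ C α′ γ

  ·-rowSplit : {A : Mat a (b ℕ.+ c)} {B : Mat k b} {C : Mat k c} {α : Fin a} {α′ : Fin k} →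
    RowSplit A B C α α′ → (W : Mat (b ℕ.+ c) e) → ∀ x →
    (A · W) α x ≡ (B · (W ∘ (_↑ˡ c))) α′ x + (C · (W ∘ (b ↑ʳ_))) α′ x
  ·-rowSplit {b = b} {c = c} {A = A} {α = α} (rowSplit left right) W x =
    trans (sumFin-splitAt b c (λ β → A α β * W β x))
          (cong₂ _+_ (sumFin-cong b (λ β → cong (_* W (β ↑ˡ c) x) (left β)))
                     (sumFin-cong c (λ γ → cong (_* W (b ↑ʳ γ) x) (right γ))))

  block-top : (P : Mat a b) (Q : Mat a c) (R : Mat k b) (S : Mat k c) (α : Fin a) →
    RowSplit (block P Q R S) P Q (α ↑ˡ k) α
  block-top {a = a} {b = b} {c = c} {k = k} P Q R S α = rowSplit left right
    where
    left : ∀ β → block P Q R S (α ↑ˡ k) (β ↑ˡ c) ≡ P α β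
    left β rewrite splitAt-↑ˡ a α k | splitAt-↑ˡ b β c = refl
    right : ∀ γ → block P Q R S (α ↑ˡ k) (b ↑ʳ γ) ≡ Q α γ
    right γ rewrite splitAt-↑ˡ a α k | splitAt-↑ʳ b c γ = refl

  block-bottom : (P : Mat a b) (Q : Mat a c) (R : Mat k b) (S : Mat k c) (α : Fin k) →
    RowSplit (block P Q R S) R S (a ↑ʳ α) α
  block-bottom {a = a} {b = b} {c = c} {k = k} P Q R S α = rowSplit left right
    where
    left : ∀ β → block P Q R S (a ↑ʳ α) (β ↑ˡ c) ≡ R α β
    left β rewrite splitAt-↑ʳ a k α | splitAt-↑ˡ b β c = refl
    right : ∀ γ → block P Q R S (a ↑ʳ α) (b ↑ʳ γ) ≡ S α γ
    right γ rewrite splitAt-↑ʳ a k α | splitAt-↑ʳ b c γ = refl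

  act-rowSplit : (K : LinMat n d a (b ℕ.+ c)) (P : LinMat n d k b) (Q : LinMat n d k c) (q : Subst n d e) →
    ∀ {α α′} → RowSplit (const K) (const P) (const Q) α α′ →
    (∀ i j k → RowSplit (coeff K i j k) (coeff P i j k) (coeff Q i j k) α α′) → ∀ W x →
    act K q W α x ≡ act P q (W ∘ (_↑ˡ c)) α′ x + act Q q (W ∘ (b ↑ʳ_)) α′ x
  act-rowSplit {n = n} {d = d} {b = b} {c = c} K P Q q {α} {α′} const-split coeff-split W x = begin
    act K q W α x
      ≡⟨ cong₂ _+_ (·-rowSplit const-split W x)
                   (trans (sumVars-cong (λ i j k → ·-rowSplit (coeff-split i j k) (W · transpose (q i j k)) x))
                          (sumVars-distrib-+ pᵢⱼₖ qᵢⱼₖ)) ⟩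
    (p₀ + q₀) + (sumVars pᵢⱼₖ + sumVars qᵢⱼₖ)
      ≡⟨ interchange p₀ q₀ (sumVars pᵢⱼₖ) (sumVars qᵢⱼₖ) ⟩
    act P q (W ∘ (_↑ˡ c)) α′ x + act Q q (W ∘ (b ↑ʳ_)) α′ x ∎
    where
    open ≡-Reasoning
    p₀ q₀ : ℚ
    p₀ = (const P · (W ∘ (_↑ˡ c))) α′ x
    q₀ = (const Q · (W ∘ (b ↑ʳ_))) α′ x
    pᵢⱼₖ qᵢⱼₖ : Fin n → Fin d → Fin d → ℚ
    pᵢⱼₖ i j k = (coeff P i j k · ((W ∘ (_↑ˡ c)) · transpose (q i j k))) α′ x
    qᵢⱼₖ i j k = (coeff Q i j k · ((W ∘ (b ↑ʳ_)) · transpose (q i j k))) α′ x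

  act-blockL-top : (P : LinMat n d a b) (Q : LinMat n d a c) (R : LinMat n d k b) (S : LinMat n d k c)
    (q : Subst n d e) (W : Mat (b ℕ.+ c) e) → ∀ α x →
    act (blockL P Q R S) q W (α ↑ˡ k) x ≡ act P q (W ∘ (_↑ˡ c)) α x + act Q q (W ∘ (b ↑ʳ_)) α x
  act-blockL-top P Q R S q W α x =
    act-rowSplit (blockL P Q R S) P Q q (block-top (const P) (const Q) (const R) (const S) α)
      (λ i j k → block-top (coeff P i j k) (coeff Q i j k) (coeff R i j k) (coeff S i j k) α) W x

  act-blockL-bottom : (P : LinMat n d a b) (Q : LinMat n d a c) (R : LinMat n d k b) (S : LinMat n d k c)
    (q : Subst n d e) (W : Mat (b ℕ.+ c) e) → ∀ α x →
    act (blockL P Q R S) q W (a ↑ʳ α) x ≡ act R q (W ∘ (_↑ˡ c)) α x + act S q (W ∘ (b ↑ʳ_)) α x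
  act-blockL-bottom P Q R S q W α x =
    act-rowSplit (blockL P Q R S) R S q (block-bottom (const P) (const Q) (const R) (const S) α)
      (λ i j k → block-bottom (coeff P i j k) (coeff Q i j k) (coeff R i j k) (coeff S i j k) α) W x

  idM⊖evalLin-·ᵥ : (L : LinMat n d a a) (q : Subst n d e) (u : Vector ℚ (a ℕ.* e)) → ∀ α x →
    ((idM ⊖ evalLin L q) ·ᵥ u) (combine α x) ≡ act (idMinus L) q (reshape u) α x
  idM⊖evalLin-·ᵥ L q u α x = begin
    ((idM ⊖ evalLin L q) ·ᵥ u) (combine α x)
      ≡⟨ ⊖-·ᵥ idM (evalLin L q) u (combine α x) ⟩
    (idM ·ᵥ u) (combine α x) - (evalLin L q ·ᵥ u) (combine α x)
      ≡⟨ cong₂ _-_ (idM-·ᵥ u (combine α x)) (evalLin-·ᵥ L q u α x) ⟩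
    u (combine α x) - act L q (reshape u) α x
      ≡⟨ act-idMinus L q (reshape u) α x ⟨
    act (idMinus L) q (reshape u) α x ∎
    where open ≡-Reasoning

  ∀-combine : {P : Fin (a ℕ.* b) → Set} → (∀ i j → P (combine i j)) → ∀ I → P I
  ∀-combine {a = a} {b = b} P-combine I with i , j , refl ← combine-surjective {a} {b} I = P-combine i j

  -- evalLin K′ q = (U ⊗ I) · evalLin K q · (V ⊗ I), and (V ⊗ I) · (V⁻¹ ⊗ I) = I.
  kernel-sandwich : {K′ : LinMat n d a m} (U : Mat a c) (U⁻¹ : Mat c a) (K : LinMat n d c l)
    (V : Mat l m) (V⁻¹ : Mat m l) → (U⁻¹ · U) ≐ idM → (V · V⁻¹) ≐ idM → K′ ≋ sandwich U K V →
    (q : Subst n d e) (w : Vector ℚ (l ℕ.* e)) →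
    IsZero (evalLin K′ q ·ᵥ (V⁻¹ ⊗ idM) ·ᵥ w) → IsZero (evalLin K q ·ᵥ w)
  kernel-sandwich {m = m} {e = e} {K′ = K′} U U⁻¹ K V V⁻¹ U⁻¹U≐I VV⁻¹≐I K′≋UKV q w K′w≡0 =
    ∀-combine (λ γ x → trans (evalLin-·ᵥ K q w γ x) (Kw≡0 x γ))
    where
    open ≡-Reasoning
    Z : Mat m e
    Z = reshape ((V⁻¹ ⊗ idM) ·ᵥ w)
    VZ≐w : (V · Z) ≐ reshape w
    VZ≐w δ y = begin
      (V · Z) δ y                  ≡⟨ ·-congʳ V (⊗idM-·ᵥ V⁻¹ w) δ y ⟩
      (V · (V⁻¹ · reshape w)) δ y  ≡⟨ ·-assoc V V⁻¹ (reshape w) δ y ⟨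
      ((V · V⁻¹) · reshape w) δ y  ≡⟨ ·-congˡ VV⁻¹≐I (reshape w) δ y ⟩
      (idM · reshape w) δ y        ≡⟨ idM-·ᵥ (λ β → reshape w β y) δ ⟩
      reshape w δ y                ∎
    UKw≡0 : ∀ x α → (U · act K q (reshape w)) α x ≡ 0ℚ
    UKw≡0 x α = begin
      (U · act K q (reshape w)) α x                     ≡⟨ ·-congʳ U (act-congʳ K q VZ≐w) α x ⟨
      (U · act K q (V · Z)) α x                         ≡⟨ act-sandwich U K V q Z α x ⟨
      act (sandwich U K V) q Z α x                      ≡⟨ act-cong≋ q K′≋UKV Z α x ⟨
      act K′ q Z α x                                    ≡⟨ evalLin-·ᵥ K′ q ((V⁻¹ ⊗ idM) ·ᵥ w) α x ⟨
      (evalLin K′ q ·ᵥ (V⁻¹ ⊗ idM) ·ᵥ w) (combine α x)  ≡⟨ K′w≡0 (combine α x) ⟩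
      0ℚ                                                ∎
    Kw≡0 : ∀ x → IsZero (λ γ → act K q (reshape w) γ x)
    Kw≡0 x γ = trans (leftInverse-solve U⁻¹ U U⁻¹U≐I (λ γ′ → act K q (reshape w) γ′ x) (λ _ → 0ℚ) (UKw≡0 x) γ)
                     (·ᵥ-zero U⁻¹ (λ _ → refl) γ)
open LinearMatrices

module BlockColumns where
  open Q using (_+_; _*_)

  -- Column 0 of select p J₀ y₀ is the unit vector at the (J₀, y₀) entry of the lower block;
  -- column suc I is the unit vector at entry I of the upper block.
  selectRow : ∀ p → Fin m → Fin e → Fin (p ℕ.+ m) → Fin e → Vector ℚ (suc (p ℕ.* e))
  selectRow p J₀ y₀ γ y =
    [ (λ β → idM (suc (combine β y))) , (λ j t → idM (combine j y) (combine J₀ y₀) * idM zero t) ]′ (splitAt p γ)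

  select : ∀ p → Fin m → Fin e → Mat ((p ℕ.+ m) ℕ.* e) (suc (p ℕ.* e))
  select {m = m} {e = e} p J₀ y₀ Δ = uncurry (selectRow p J₀ y₀) (remQuot {p ℕ.+ m} e Δ)

  select-combine : ∀ p (J₀ : Fin m) (y₀ : Fin e) (γ : Fin (p ℕ.+ m)) (y : Fin e) →
    select p J₀ y₀ (combine γ y) ≡ selectRow p J₀ y₀ γ y
  select-combine {m = m} {e = e} p J₀ y₀ γ y =
    cong (uncurry (selectRow p J₀ y₀)) (remQuot-combine {p ℕ.+ m} {e} γ y)

  select-top : ∀ p (J₀ : Fin m) (y₀ : Fin e) (c : Vector ℚ (suc (p ℕ.* e))) → ∀ β y →
    (select p J₀ y₀ ·ᵥ c) (combine (β ↑ˡ m) y) ≡ c (suc (combine β y))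
  select-top {m = m} {e = e} p J₀ y₀ c β y =
    trans (sumFin-cong (suc (p ℕ.* e)) (λ t → cong (_* c t) (row t)))
          (sumFin-idMˡ (suc (p ℕ.* e)) (suc (combine β y)) c)
    where
    row : ∀ t → select p J₀ y₀ (combine (β ↑ˡ m) y) t ≡ idM (suc (combine β y)) t
    row t = cong (λ r → r t) (trans (select-combine p J₀ y₀ (β ↑ˡ m) y)
                                    (cong [ _ , _ ]′ (splitAt-↑ˡ p β m)))

  select-bottom : ∀ p (J₀ : Fin m) (y₀ : Fin e) (c : Vector ℚ (suc (p ℕ.* e))) → ∀ j y →
    (select p J₀ y₀ ·ᵥ c) (combine (p ↑ʳ j) y) ≡ single (combine J₀ y₀) (c zero) (combine j y)
  select-bottom {m = m} {e = e} p J₀ y₀ c j y = begin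
    (select p J₀ y₀ ·ᵥ c) (combine (p ↑ʳ j) y)
      ≡⟨ sumFin-cong (suc (p ℕ.* e)) (λ t → trans (cong (_* c t) (row t)) (ℚP.*-assoc δ (idM zero t) (c t))) ⟩
    sumFin (suc (p ℕ.* e)) (λ t → δ * (idM zero t * c t))
      ≡⟨ *-distribˡ-sumFin (suc (p ℕ.* e)) δ (λ t → idM zero t * c t) ⟨
    δ * sumFin (suc (p ℕ.* e)) (λ t → idM zero t * c t)
      ≡⟨ cong (δ *_) (sumFin-idMˡ (suc (p ℕ.* e)) zero c) ⟩
    δ * c zero ∎
    where
    open ≡-Reasoning
    δ : ℚ
    δ = idM (combine j y) (combine J₀ y₀)
    row : ∀ t → select p J₀ y₀ (combine (p ↑ʳ j) y) t ≡ δ * idM zero t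
    row t = cong (λ r → r t) (trans (select-combine p J₀ y₀ (p ↑ʳ j) y)
                                    (cong [ _ , _ ]′ (splitAt-↑ʳ p m j)))

  blockL-columns-independent :
    (L : LinMat n d p p) (A : LinMat n d p m) (B : LinMat n d m p) (C : LinMat n d m m)
    (q : Subst n d e) (N : Mat (p ℕ.* e) (p ℕ.* e)) → (N · (idM ⊖ evalLin L q)) ≐ idM →
    {I₀ : Fin (m ℕ.* e)} {J₀ : Fin m} {y₀ : Fin e} →
    (evalLin C q ⊖ (evalLin B q · N · evalLin A q)) I₀ (combine J₀ y₀) ≢ 0ℚ →
    TrivialKernel (evalLin (blockL (idMinus L) A B C) q · select p J₀ y₀)
  blockL-columns-independent {n = n} {d = d} {p = p} {m = m} {e = e} L A B C q N NP≐I {J₀ = J₀} {y₀}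
                             schur≢0 c Sc≡0 = c≡0
    where
    open ≡-Reasoning
    Blk : LinMat n d (p ℕ.+ m) (p ℕ.+ m)
    Blk = blockL (idMinus L) A B C
    w : Vector ℚ ((p ℕ.+ m) ℕ.* e)
    w = select p J₀ y₀ ·ᵥ c
    u : Vector ℚ (p ℕ.* e)
    u I = c (suc I)
    v : Vector ℚ (m ℕ.* e)
    v = single (combine J₀ y₀) (c zero)
    Blk-w≡0 : IsZero (evalLin Blk q ·ᵥ w)
    Blk-w≡0 I = trans (sym (·ᵥ-assoc (evalLin Blk q) (select p J₀ y₀) c I)) (Sc≡0 I)
    top-rows : (reshape w ∘ (_↑ˡ m)) ≐ reshape u
    top-rows = select-top p J₀ y₀ c
    bottom-rows : (reshape w ∘ (p ↑ʳ_)) ≐ reshape v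
    bottom-rows = select-bottom p J₀ y₀ c
    top≡0 : IsZero (λ I → ((idM ⊖ evalLin L q) ·ᵥ u) I + (evalLin A q ·ᵥ v) I)
    top≡0 = ∀-combine (λ α x → begin
      ((idM ⊖ evalLin L q) ·ᵥ u) (combine α x) + (evalLin A q ·ᵥ v) (combine α x)
        ≡⟨ cong₂ _+_ (idM⊖evalLin-·ᵥ L q u α x) (evalLin-·ᵥ A q v α x) ⟩
      act (idMinus L) q (reshape u) α x + act A q (reshape v) α x
        ≡⟨ cong₂ _+_ (act-congʳ (idMinus L) q top-rows α x) (act-congʳ A q bottom-rows α x) ⟨
      act (idMinus L) q (reshape w ∘ (_↑ˡ m)) α x + act A q (reshape w ∘ (p ↑ʳ_)) α x
        ≡⟨ act-blockL-top (idMinus L) A B C q (reshape w) α x ⟨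
      act Blk q (reshape w) (α ↑ˡ m) x
        ≡⟨ evalLin-·ᵥ Blk q w (α ↑ˡ m) x ⟨
      (evalLin Blk q ·ᵥ w) (combine (α ↑ˡ m) x)
        ≡⟨ Blk-w≡0 (combine (α ↑ˡ m) x) ⟩
      0ℚ ∎)
    bottom≡0 : IsZero (λ J → (evalLin B q ·ᵥ u) J + (evalLin C q ·ᵥ v) J)
    bottom≡0 = ∀-combine (λ j x → begin
      (evalLin B q ·ᵥ u) (combine j x) + (evalLin C q ·ᵥ v) (combine j x)
        ≡⟨ cong₂ _+_ (evalLin-·ᵥ B q u j x) (evalLin-·ᵥ C q v j x) ⟩
      act B q (reshape u) j x + act C q (reshape v) j x
        ≡⟨ cong₂ _+_ (act-congʳ B q top-rows j x) (act-congʳ C q bottom-rows j x) ⟨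
      act B q (reshape w ∘ (_↑ˡ m)) j x + act C q (reshape w ∘ (p ↑ʳ_)) j x
        ≡⟨ act-blockL-bottom (idMinus L) A B C q (reshape w) j x ⟨
      act Blk q (reshape w) (p ↑ʳ j) x
        ≡⟨ evalLin-·ᵥ Blk q w (p ↑ʳ j) x ⟨
      (evalLin Blk q ·ᵥ w) (combine (p ↑ʳ j) x)
        ≡⟨ Blk-w≡0 (combine (p ↑ʳ j) x) ⟩
      0ℚ ∎)
    schur : c zero ≡ 0ℚ × IsZero u
    schur = schur-columns-independent (idM ⊖ evalLin L q) (evalLin A q) (evalLin B q) (evalLin C q)
              NP≐I schur≢0 u (c zero) top≡0 bottom≡0
    c≡0 : IsZero c
    c≡0 zero    = proj₁ schur
    c≡0 (suc I) = proj₂ schur I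
open BlockColumns

module Substitution where
  open Q using (_+_; _*_)
  open +-*-Solver

  private variable s : ℕ

  -- p′ᵢ = pᵢ ⊗ I + Σⱼₖ Eⱼₖ ⊗ qᵢⱼₖ: the generic matrix Zᵢ + pᵢ with each variable z⁽ⁱ⁾ⱼₖ
  -- replaced by the block qᵢⱼₖ.
  substitute : (p : Fin n → Mat d d) → Subst n d e → Fin n → Mat (d ℕ.* e) (d ℕ.* e)
  substitute {d = d} p q i = (p i ⊗ idM) ⊕ sumMat d (λ j → sumMat d (λ k → unitM j k ⊗ q i j k))

  substitute-entry : (p : Fin n → Mat d d) (q : Subst n d e) → ∀ i b x b′ y →
    substitute p q i (combine b x) (combine b′ y) ≡ p i b b′ * idM x y + q i b b′ x y
  substitute-entry {d = d} p q i b x b′ y =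
    cong₂ _+_ (⊗-entry (p i) idM b x b′ y) (begin
      sumMat d (λ j → sumMat d (λ k → unitM j k ⊗ q i j k)) (combine b x) (combine b′ y)
        ≡⟨ sumMat-entry d _ (combine b x) (combine b′ y) ⟩
      sumFin d (λ j → sumMat d (λ k → unitM j k ⊗ q i j k) (combine b x) (combine b′ y))
        ≡⟨ sumFin-cong d (λ j → trans (sumMat-entry d _ (combine b x) (combine b′ y))
                                      (sumFin-cong d (λ k → ⊗-entry (unitM j k) (q i j k) b x b′ y))) ⟩
      sumFin d (λ j → sumFin d (λ k → unitM j k b b′ * q i j k x y))
        ≡⟨ sumFin-unitM d (λ j k → q i j k x y) b b′ ⟩
      q i b b′ x y ∎)
    where open ≡-Reasoning

  evalT-entry : (A₀ : Mat s s) (As : Fin n → Mat s s) (p : Fin n → Mat e e) → ∀ a b a′ b′ →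
    evalT n A₀ As p (combine a b) (combine a′ b′) ≡ A₀ a a′ * idM b b′ + sumFin n (λ i → As i a a′ * p i b b′)
  evalT-entry {n = n} A₀ As p a b a′ b′ =
    cong₂ _+_ (⊗-entry A₀ idM a b a′ b′)
              (trans (sumMat-entry n (λ i → As i ⊗ p i) (combine a b) (combine a′ b′))
                     (sumFin-cong n (λ i → ⊗-entry (As i) (p i) a b a′ b′)))

  evalLin-TdShift-entry : (A₀ : Mat s s) (As : Fin n → Mat s s) (p : Fin n → Mat d d) (q : Subst n d e) →
    ∀ a b x a′ b′ y →
    evalLin (TdShift n A₀ As p) q (combine (combine a b) x) (combine (combine a′ b′) y)
      ≡ evalT n A₀ As p (combine a b) (combine a′ b′) * idM x y + sumFin n (λ i → As i a a′ * q i b b′ x y)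
  evalLin-TdShift-entry {s = s} {n = n} {d = d} {e = e} A₀ As p q a b x a′ b′ y =
    cong₂ _+_ (⊗-entry (evalT n A₀ As p) idM (combine a b) x (combine a′ b′) y) (begin
      sumMatVars F (combine (combine a b) x) (combine (combine a′ b′) y)
        ≡⟨ sumMatVars-entry F (combine (combine a b) x) (combine (combine a′ b′) y) ⟩
      sumVars (λ i j k → F i j k (combine (combine a b) x) (combine (combine a′ b′) y))
        ≡⟨ sumVars-cong (λ i j k →
             trans (⊗-entry (As i ⊗ unitM j k) (q i j k) (combine a b) x (combine a′ b′) y)
                   (trans (cong (_* q i j k x y) (⊗-entry (As i) (unitM j k) a b a′ b′))
                          (rearrange (As i a a′) (unitM j k b b′) (q i j k x y)))) ⟩
      sumVars (λ i j k → unitM j k b b′ * (As i a a′ * q i j k x y))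
        ≡⟨ sumFin-cong n (λ i → sumFin-unitM d (λ j k → As i a a′ * q i j k x y) b b′) ⟩
      sumFin n (λ i → As i a a′ * q i b b′ x y) ∎)
    where
    open ≡-Reasoning
    F : Fin n → Fin d → Fin d → Mat ((s ℕ.* d) ℕ.* e) ((s ℕ.* d) ℕ.* e)
    F i j k = (As i ⊗ unitM j k) ⊗ q i j k
    rearrange : ∀ a u z → (a * u) * z ≡ u * (a * z)
    rearrange = solve 3 (λ a u z → (a :* u) :* z := u :* (a :* z)) refl

  evalT-substitute : (A₀ : Mat s s) (As : Fin n → Mat s s) (p : Fin n → Mat d d) (q : Subst n d e) →
    ∀ a b x a′ b′ y →
    evalT n A₀ As (substitute p q) (combine a (combine b x)) (combine a′ (combine b′ y))
      ≡ evalLin (TdShift n A₀ As p) q (combine (combine a b) x) (combine (combine a′ b′) y)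
  evalT-substitute {n = n} A₀ As p q a b x a′ b′ y = begin
    evalT n A₀ As (substitute p q) (combine a (combine b x)) (combine a′ (combine b′ y))
      ≡⟨ evalT-entry A₀ As (substitute p q) a (combine b x) a′ (combine b′ y) ⟩
    A₀ a a′ * idM (combine b x) (combine b′ y) + sumFin n (λ i → As i a a′ * substitute p q i (combine b x) (combine b′ y))
      ≡⟨ cong₂ (λ δ σ → A₀ a a′ * δ + σ) (idM-combine b b′ x y)
               (sumFin-cong n (λ i → cong (As i a a′ *_) (substitute-entry p q i b x b′ y))) ⟩
    A₀ a a′ * (idM b b′ * idM x y) + sumFin n (λ i → As i a a′ * (p i b b′ * idM x y + q i b b′ x y))
      ≡⟨ cong (A₀ a a′ * (idM b b′ * idM x y) +_)
              (sumFin-linear n (λ i → As i a a′) (λ i → p i b b′) (λ i → q i b b′ x y) (idM x y)) ⟩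
    A₀ a a′ * (idM b b′ * idM x y) + (sumFin n (λ i → As i a a′ * p i b b′) * idM x y + sumFin n (λ i → As i a a′ * q i b b′ x y))
      ≡⟨ regroup (A₀ a a′) (idM b b′) (idM x y) _ _ ⟩
    (A₀ a a′ * idM b b′ + sumFin n (λ i → As i a a′ * p i b b′)) * idM x y + sumFin n (λ i → As i a a′ * q i b b′ x y)
      ≡⟨ cong (λ t → t * idM x y + sumFin n (λ i → As i a a′ * q i b b′ x y)) (evalT-entry A₀ As p a b a′ b′) ⟨
    evalT n A₀ As p (combine a b) (combine a′ b′) * idM x y + sumFin n (λ i → As i a a′ * q i b b′ x y)
      ≡⟨ evalLin-TdShift-entry A₀ As p q a b x a′ b′ y ⟨
    evalLin (TdShift n A₀ As p) q (combine (combine a b) x) (combine (combine a′ b′) y) ∎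
    where
    open ≡-Reasoning
    regroup : ∀ a δ δ′ s t → a * (δ * δ′) + (s * δ′ + t) ≡ (a * δ + s) * δ′ + t
    regroup = solve 5 (λ a δ δ′ s t → a :* (δ :* δ′) :+ (s :* δ′ :+ t) := (a :* δ :+ s) :* δ′ :+ t) refl

  reassoc : ∀ s d e → Fin ((s ℕ.* d) ℕ.* e) → Fin (s ℕ.* (d ℕ.* e))
  reassoc s d e K = combine (proj₁ ab) (combine (proj₂ ab) (proj₂ abx))
    where
    abx : Fin (s ℕ.* d) × Fin e
    abx = remQuot {s ℕ.* d} e K
    ab : Fin s × Fin d
    ab = remQuot {s} d (proj₁ abx)

  reassoc-combine : (a : Fin s) (b : Fin d) (x : Fin e) →
    reassoc s d e (combine (combine a b) x) ≡ combine a (combine b x)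
  reassoc-combine {s = s} {d = d} {e = e} a b x =
    trans (cong (λ r → combine (proj₁ (remQuot {s} d (proj₁ r))) (combine (proj₂ (remQuot {s} d (proj₁ r))) (proj₂ r)))
                (remQuot-combine {s ℕ.* d} {e} (combine a b) x))
          (cong (λ r → combine (proj₁ r) (combine (proj₂ r) x)) (remQuot-combine {s} {d} a b))

  evalLin-TdShift-reassoc : (A₀ : Mat s s) (As : Fin n → Mat s s) (p : Fin n → Mat d d) (q : Subst n d e) →
    ∀ I J → evalLin (TdShift n A₀ As p) q I J ≡ evalT n A₀ As (substitute p q) (reassoc s d e I) (reassoc s d e J)
  evalLin-TdShift-reassoc {s = s} {n = n} {d = d} {e = e} A₀ As p q I J
    with ab , x , refl ← combine-surjective {s ℕ.* d} {e} I
    with a , b , refl ← combine-surjective {s} {d} ab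
    with a′b′ , y , refl ← combine-surjective {s ℕ.* d} {e} J
    with a′ , b′ , refl ← combine-surjective {s} {d} a′b′ = begin
      evalLin (TdShift n A₀ As p) q (combine (combine a b) x) (combine (combine a′ b′) y)
        ≡⟨ evalT-substitute A₀ As p q a b x a′ b′ y ⟨
      T′ (combine a (combine b x)) (combine a′ (combine b′ y))
        ≡⟨ cong₂ T′ (reassoc-combine a b x) (reassoc-combine a′ b′ y) ⟨
      T′ (reassoc s d e (combine (combine a b) x)) (reassoc s d e (combine (combine a′ b′) y)) ∎
    where
    open ≡-Reasoning
    T′ : Mat (s ℕ.* (d ℕ.* e)) (s ℕ.* (d ℕ.* e))
    T′ = evalT n A₀ As (substitute p q)
open Substitution

open import Data.Nat using (_+_; _*_)

-- The rank hypothesis on T(p) only serves to produce the decomposition, which is given.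
corollary3p7 : (n s r d m : ℕ) (A₀ : Mat s s) (As : Fin n → Mat s s)
    (p : Fin n → Mat d d) →
    RankAtLeast (evalT n A₀ As p) (r * d) →
    (U : Mat (s * d) (r * d + m)) (U⁻¹ : Mat (r * d + m) (s * d)) →
    IsInverse U⁻¹ U →
    (V : Mat (r * d + m) (s * d)) (V⁻¹ : Mat (s * d) (r * d + m)) →
    IsInverse V⁻¹ V →
    (L : LinMat n d (r * d) (r * d)) (A : LinMat n d (r * d) m)
    (B : LinMat n d m (r * d)) (C : LinMat n d m m) →
    TdShift n A₀ As p ≋ sandwich U (blockL (idMinus L) A B C) V →
    (q : Fin n → Fin d → Fin d → Mat (2 * r * d) (2 * r * d))
    (N : Mat (r * d * (2 * r * d)) (r * d * (2 * r * d))) →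
    IsInverse N (idM ⊖ evalLin L q) →
    Σ (Fin m) (λ i → Σ (Fin m) (λ j → Σ (Fin (2 * r * d)) (λ x →
      Σ (Fin (2 * r * d)) (λ y →
        (evalLin C q ⊖ (evalLin B q · N · evalLin A q))
          (combine i x) (combine j y) ≢ 0ℚ)))) →
    Σ (Fin n → Mat (d * (2 * r * d)) (d * (2 * r * d))) (λ p′ →
      RankAtLeast (evalT n A₀ As p′) (suc (r * d * (2 * r * d))))
corollary3p7 n s r d m A₀ As p _ U U⁻¹ (U⁻¹U≐I , _) V V⁻¹ (_ , VV⁻¹≐I) L A B C T≋UBlkV q N (NP≐I , _)
             (_ , j , _ , y , schur≢0) =
  substitute p q ,
  RankAtLeast-submatrix {M = evalT n A₀ As (substitute p q)} (reassoc s d d′) (reassoc s d d′)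
    (evalLin-TdShift-reassoc A₀ As p q) (rankAtLeast-of-product _ Tq H TqH-trivialKernel)
  where
  d′ : ℕ
  d′ = 2 * r * d
  Tq : Mat (s * d * d′) (s * d * d′)
  Tq = evalLin (TdShift n A₀ As p) q
  Blk : LinMat n d (r * d + m) (r * d + m)
  Blk = blockL (idMinus L) A B C
  S : Mat ((r * d + m) * d′) (suc (r * d * d′))
  S = select (r * d) j y
  H : Mat (s * d * d′) (suc (r * d * d′))
  H = (V⁻¹ ⊗ idM) · S
  TqH-trivialKernel : TrivialKernel (Tq · H)
  TqH-trivialKernel c TqHc≡0 = blockL-columns-independent L A B C q N NP≐I schur≢0 c BlkSc≡0
    where
    Tq-Sc≡0 : IsZero (Tq ·ᵥ (V⁻¹ ⊗ idM) ·ᵥ S ·ᵥ c)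
    Tq-Sc≡0 I = trans (sym (trans (·ᵥ-assoc Tq H c I) (·ᵥ-congʳ Tq (·ᵥ-assoc (V⁻¹ ⊗ idM) S c) I)))
                      (TqHc≡0 I)
    BlkSc≡0 : IsZero ((evalLin Blk q · S) ·ᵥ c)
    BlkSc≡0 I = trans (·ᵥ-assoc (evalLin Blk q) S c I)
                      (kernel-sandwich U U⁻¹ Blk V V⁻¹ U⁻¹U≐I VV⁻¹≐I T≋UBlkV q (S ·ᵥ c) Tq-Sc≡0 I)
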